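{- (1) $\to_{\bar\lambda}$ and $\to_{\tilde\mu}$ are each strongly normalizing and strongly confluent. (2) $\to_{\bar\lambda}$ and $\to_{\tilde\mu}$ strongly commute. (3) $\to_{\mathsf{vseq}}$ is strongly confluent, and all $\mathsf{vseq}$-normalizing derivations $d$ from a given command $c$ (if any) have the same length $|d|$, the same number $|d|_{\tilde\mu}$ of $\tilde\mu$-steps, and the same number $|d|_{\bar\lambda}$ of $\bar\lambda$-steps.
   Context: Value sequent calculus: commands $c::=\langle v\mid e\rangle$; values $v::=x\mid\lambda x.c$; environments $e::=\epsilon\mid\tilde\mu x.c\mid v\cdot e$, where $\lambda x.c$ and $\tilde\mu x.c$ bind $x$ in $c$; up to $\alpha$; $c\{x\leftarrow v\}$ capture-avoiding substitution. Append: $\langle v\mid e'\rangle@e=\langle v\mid e'@e\rangle$; $\epsilon@e=e$; $(v\cdot e')@e=v\cdot(e'@e)$; $(\tilde\mu x.c)@e=\tilde\mu y.(c\{x\leftarrow y\}@e)$ with $y$ fresh. Contexts: $C::=\langle\cdot\rangle\mid D\langle\tilde\mu x.C\rangle$, $D::=\langle v\mid\langle\cdot\rangle\rangle\mid D\langle v\cdot\langle\cdot\rangle\rangle$. $\to_{\bar\lambda}$ and $\to_{\tilde\mu}$ are the closures under contexts $C$ of $\langle\lambda x.c\mid v\cdot e\rangle\mapsto\langle v\mid(\tilde\mu x.c)@e\rangle$ and $\langle v\mid\tilde\mu x.c\rangle\mapsto c\{x\leftarrow v\}$; $\to_{\mathsf{vseq}}=\to_{\bar\lambda}\cup\to_{\tilde\mu}$.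 Strongly normalizing: no infinite sequence. Strongly confluent: $s\leftarrow t\to u$, $u\ne s$ implies $u\to r\leftarrow s$ for some $r$. $\to_1,\to_2$ strongly commute: $u\leftarrow_1 t\to_2 s$ implies $u\ne s$ and $u\to_2 r\leftarrow_1 s$ for some $r$. -}

module Defs where

open import Data.Nat using (ℕ; zero; suc)
open import Data.Fin using (Fin; zero; suc)
open import Data.Product using (Σ; ∃; _×_; _,_)
open import Data.Sum using (_⊎_; inj₁; inj₂)
open import Data.Empty using (⊥)
open import Relation.Nullary using (¬_)
open import Relation.Binary.PropositionalEquality using (_≡_; _≢_)
open import Relation.Binary.Construct.Closure.ReflexiveTransitive using (Star; ε; _◅_)

-- Syntax of the value sequent calculus, well-scoped de Bruijn indices
-- (terms up to α-equivalence = syntactic equality of de Bruijn terms).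

infix 5 ⟨_∣_⟩
infixr 6 _·_

mutual
  data Cmd (n : ℕ) : Set where
    ⟨_∣_⟩ : Val n → Env n → Cmd n

  data Val (n : ℕ) : Set where
    var : Fin n → Val n
    lam : Cmd (suc n) → Val n

  data Env (n : ℕ) : Set where
    ε   : Env n
    μ̃   : Cmd (suc n) → Env n
    _·_ : Val n → Env n → Env n

Ren : ℕ → ℕ → Set
Ren n m = Fin n → Fin m

extR : ∀ {n m} → Ren n m → Ren (suc n) (suc m)
extR ρ zero    = zero
extR ρ (suc i) = suc (ρ i)

mutual
  renC : ∀ {n m} → Ren n m → Cmd n → Cmd m
  renC ρ ⟨ v ∣ e ⟩ = ⟨ renV ρ v ∣ renE ρ e ⟩

  renV : ∀ {n m} → Ren n m → Val n → Val m
  renV ρ (var i) = var (ρ i)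
  renV ρ (lam c) = lam (renC (extR ρ) c)

  renE : ∀ {n m} → Ren n m → Env n → Env m
  renE ρ ε       = ε
  renE ρ (μ̃ c)   = μ̃ (renC (extR ρ) c)
  renE ρ (v · e) = renV ρ v · renE ρ e

Sub : ℕ → ℕ → Set
Sub n m = Fin n → Val m

extS : ∀ {n m} → Sub n m → Sub (suc n) (suc m)
extS σ zero    = var zero
extS σ (suc i) = renV suc (σ i)

mutual
  subC : ∀ {n m} → Sub n m → Cmd n → Cmd m
  subC σ ⟨ v ∣ e ⟩ = ⟨ subV σ v ∣ subE σ e ⟩

  subV : ∀ {n m} → Sub n m → Val n → Val m
  subV σ (var i) = σ i
  subV σ (lam c) = lam (subC (extS σ) c)

  subE : ∀ {n m} → Sub n m → Env n → Env m
  subE σ ε       = ε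
  subE σ (μ̃ c)   = μ̃ (subC (extS σ) c)
  subE σ (v · e) = subV σ v · subE σ e

single : ∀ {n} → Val n → Sub (suc n) n
single v zero    = v
single v (suc i) = var i

_[_] : ∀ {n} → Cmd (suc n) → Val n → Cmd n
c [ v ] = subC (single v) c

mutual
  _++C_ : ∀ {n} → Cmd n → Env n → Cmd n
  ⟨ v ∣ e' ⟩ ++C e = ⟨ v ∣ e' ++E e ⟩

  _++E_ : ∀ {n} → Env n → Env n → Env n
  ε        ++E e = e
  (v · e') ++E e = v · (e' ++E e)
  -- (μ̃x.c)@e = μ̃y.(c{x←y}@e), y fresh: the bound variable stays index 0,
  -- e is weakened past the binder
  μ̃ c      ++E e = μ̃ (c ++C renE suc e)

-- Contexts  C ::= ⟨·⟩ | D⟨μ̃x.C⟩ ,  D ::= ⟨v∣⟨·⟩⟩ | D⟨v·⟨·⟩⟩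
-- CCtx n m : context over n free variables whose hole has scope m.

data DCtx (n : ℕ) : Set where
  ⟨_∣□⟩ : Val n → DCtx n
  _⟨_·□⟩ : DCtx n → Val n → DCtx n

plugD : ∀ {n} → DCtx n → Env n → Cmd n
plugD ⟨ v ∣□⟩     e = ⟨ v ∣ e ⟩
plugD (D ⟨ v ·□⟩) e = plugD D (v · e)

data CCtx (n : ℕ) : ℕ → Set where
  □     : CCtx n n
  _⟨μ̃_⟩ : ∀ {m} → DCtx n → CCtx (suc n) m → CCtx n m

plugC : ∀ {n m} → CCtx n m → Cmd m → Cmd n
plugC □            c = c
plugC (D ⟨μ̃ C ⟩) c = plugD D (μ̃ (plugC C c))

data _↦λ̄_ {n : ℕ} : Cmd n → Cmd n → Set where
  λ̄-rule : ∀ (c : Cmd (suc n)) (v : Val n) (e : Env n) →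
           ⟨ lam c ∣ v · e ⟩ ↦λ̄ ⟨ v ∣ μ̃ c ++E e ⟩

data _↦μ̃_ {n : ℕ} : Cmd n → Cmd n → Set where
  μ̃-rule : ∀ (v : Val n) (c : Cmd (suc n)) →
           ⟨ v ∣ μ̃ c ⟩ ↦μ̃ (c [ v ])

data _→λ̄_ {n : ℕ} : Cmd n → Cmd n → Set where
  ctx : ∀ {m} (C : CCtx n m) {c c' : Cmd m} →
        c ↦λ̄ c' → plugC C c →λ̄ plugC C c'

data _→μ̃_ {n : ℕ} : Cmd n → Cmd n → Set where
  ctx : ∀ {m} (C : CCtx n m) {c c' : Cmd m} →
        c ↦μ̃ c' → plugC C c →μ̃ plugC C c'

_→vseq_ : ∀ {n} → Cmd n → Cmd n → Set
c →vseq c' = (c →λ̄ c') ⊎ (c →μ̃ c')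

module _ {A : Set} where

  StronglyNormalizing : (A → A → Set) → Set
  StronglyNormalizing _⇒_ =
    ¬ (Σ (ℕ → A) λ f → ∀ i → f i ⇒ f (suc i))

  StronglyConfluent : (A → A → Set) → Set
  StronglyConfluent _⇒_ =
    ∀ {t s u} → t ⇒ s → t ⇒ u → u ≢ s → ∃ λ r → (u ⇒ r) × (s ⇒ r)

  StronglyCommute : (A → A → Set) → (A → A → Set) → Set
  StronglyCommute _⇒₁_ _⇒₂_ =
    ∀ {t u s} → t ⇒₁ u → t ⇒₂ s → (u ≢ s) × (∃ λ r → (u ⇒₂ r) × (s ⇒₁ r))

  Normal : (A → A → Set) → A → Set
  Normal _⇒_ a = ¬ (∃ λ b → a ⇒ b)

Derivation : ∀ {n} → Cmd n → Cmd n → Set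
Derivation = Star _→vseq_

∣_∣ : ∀ {n} {c c' : Cmd n} → Derivation c c' → ℕ
∣ ε ∣     = 0
∣ _ ◅ d ∣ = suc ∣ d ∣

∣_∣μ̃ : ∀ {n} {c c' : Cmd n} → Derivation c c' → ℕ
∣ ε ∣μ̃          = 0
∣ inj₁ _ ◅ d ∣μ̃ = ∣ d ∣μ̃
∣ inj₂ _ ◅ d ∣μ̃ = suc ∣ d ∣μ̃

∣_∣λ̄ : ∀ {n} {c c' : Cmd n} → Derivation c c' → ℕ
∣ ε ∣λ̄          = 0
∣ inj₁ _ ◅ d ∣λ̄ = suc ∣ d ∣λ̄
∣ inj₂ _ ◅ d ∣λ̄ = ∣ d ∣λ̄

-- Both rules are linear in the surrounding context: λ̄ moves the rest of the
-- stack behind the new μ̃-binder and μ̃ substitutes a value, so neither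
-- duplicates nor erases a redex in its environment. Any two distinct steps
-- therefore close in one step each, with their kinds swapped, and a
-- random-descent argument shows that all normalizing derivations perform the
-- same multiset of step kinds. λ̄ decreases the number of λ-abstractions; μ̃
-- decreases the number of μ̃-binders outside values, which λ̄ increases, so a
-- λ̄-step and a μ̃-step never reach the same command.
module Submission where

open import Defs
open import Data.Nat using (ℕ; zero; suc; _+_; _<_; s≤s)
open import Data.Nat.Induction using (<-wellFounded)
open import Data.Nat.Properties using (+-suc; +-assoc; +-comm; m≤n+m; ≤-reflexive; <-trans; <-irrefl)
open import Data.Fin using (zero; suc)
open import Data.Product using (Σ; ∃; _×_; _,_)
open import Data.Sum using (_⊎_; inj₁; inj₂)
open import Data.Empty using (⊥; ⊥-elim)
open import Function using (_∘_; flip; const)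
open import Induction.WellFounded using (WellFounded; Acc; acc; module Subrelation)
open import Relation.Binary.Construct.On as On using ()
open import Relation.Binary.PropositionalEquality hiding ([_])
open import Relation.Binary.Construct.Closure.ReflexiveTransitive using (Star; ε; _◅_)

Joinable : ∀ {A : Set} → (A → A → Set) → (A → A → Set) → A → A → Set
Joinable R S u s = ∃ λ r → R u r × S s r

module _ {A : Set} {_⇒_ : A → A → Set} where

  wellFounded⇒SN : WellFounded (flip _⇒_) → StronglyNormalizing _⇒_
  wellFounded⇒SN wf (f , chain) = noChainFrom 0 (wf (f 0))
    where
    noChainFrom : ∀ i → Acc (flip _⇒_) (f i) → ⊥
    noChainFrom i (acc rs) = noChainFrom (suc i) (rs (chain i))

  decreasing⇒SN : (μ : A → ℕ) → (∀ {a b} → a ⇒ b → μ b < μ a) → StronglyNormalizing _⇒_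
  decreasing⇒SN μ dec = wellFounded⇒SN (Subrelation.wellFounded dec (On.wellFounded μ <-wellFounded))

module LabelledRewriting {A L : Set} (_⇒_ : A → A → Set) (label : ∀ {a b} → a ⇒ b → L) where

  LabelledDiamond : Set
  LabelledDiamond = ∀ {t u s} (x : t ⇒ u) (y : t ⇒ s) →
    (label x ≡ label y × u ≡ s) ⊎
    ∃ λ r → Σ (u ⇒ r) λ y' → Σ (s ⇒ r) λ x' → label y' ≡ label y × label x' ≡ label x

  weight : (L → ℕ) → ∀ {a b} → Star _⇒_ a b → ℕ
  weight w ε       = 0
  weight w (x ◅ d) = w (label x) + weight w d

  module _ (diamond : LabelledDiamond) where

    stronglyConfluent : StronglyConfluent _⇒_
    stronglyConfluent x y u≢s with diamond x y
    ... | inj₁ (_ , s≡u)              = ⊥-elim (u≢s (sym s≡u))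
    ... | inj₂ (r , y' , x' , _ , _) = r , x' , y'

    reroute : ∀ {t s b} (d : Star _⇒_ t b) → Normal _⇒_ b → (y : t ⇒ s) →
              Σ (Star _⇒_ s b) λ d' → ∀ w → weight w d ≡ w (label y) + weight w d'
    reroute ε nf y = ⊥-elim (nf (_ , y))
    reroute (x ◅ d) nf y with diamond x y
    ... | inj₁ (x≡y , refl) = d , λ w → cong (λ l → w l + weight w d) x≡y
    ... | inj₂ (r , y' , x' , y'≡y , x'≡x) with reroute d nf y'
    ...   | d' , d≈y'd' = x' ◅ d' , λ w → begin
      w (label x) + weight w d                     ≡⟨ cong (w (label x) +_) (d≈y'd' w) ⟩
      w (label x) + (w (label y') + weight w d')   ≡⟨ +-assoc (w (label x)) _ _ ⟨
      (w (label x) + w (label y')) + weight w d'   ≡⟨ cong (_+ weight w d') (+-comm (w (label x)) _) ⟩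
      (w (label y') + w (label x)) + weight w d'   ≡⟨ +-assoc (w (label y')) _ _ ⟩
      w (label y') + (w (label x) + weight w d')   ≡⟨ cong₂ (λ l l' → w l + (w l' + weight w d')) y'≡y (sym x'≡x) ⟩
      w (label y) + (w (label x') + weight w d')   ∎
      where open ≡-Reasoning

    normalizing-weight-unique : ∀ {t b₁ b₂} (d₁ : Star _⇒_ t b₁) (d₂ : Star _⇒_ t b₂) →
                                Normal _⇒_ b₁ → Normal _⇒_ b₂ → ∀ w → weight w d₁ ≡ weight w d₂
    normalizing-weight-unique ε       ε        _   _   w = refl
    normalizing-weight-unique (x ◅ _) ε        _   nf₂ w = ⊥-elim (nf₂ (_ , x))
    normalizing-weight-unique d₁      (y ◅ d₂) nf₁ nf₂ w with reroute d₁ nf₁ y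
    ... | d₁' , d₁≈yd₁' =
      trans (d₁≈yd₁' w) (cong (w (label y) +_) (normalizing-weight-unique d₁' d₂ nf₁ nf₂ w))

extR-cong : ∀ {n m} {ρ ρ' : Ren n m} → ρ ≗ ρ' → extR ρ ≗ extR ρ'
extR-cong h zero    = refl
extR-cong h (suc i) = cong suc (h i)

mutual
  renC-cong : ∀ {n m} {ρ ρ' : Ren n m} → ρ ≗ ρ' → renC ρ ≗ renC ρ'
  renC-cong h ⟨ v ∣ e ⟩ = cong₂ ⟨_∣_⟩ (renV-cong h v) (renE-cong h e)

  renV-cong : ∀ {n m} {ρ ρ' : Ren n m} → ρ ≗ ρ' → renV ρ ≗ renV ρ'
  renV-cong h (var i) = cong var (h i)
  renV-cong h (lam c) = cong lam (renC-cong (extR-cong h) c)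

  renE-cong : ∀ {n m} {ρ ρ' : Ren n m} → ρ ≗ ρ' → renE ρ ≗ renE ρ'
  renE-cong h ε       = refl
  renE-cong h (μ̃ c)   = cong μ̃ (renC-cong (extR-cong h) c)
  renE-cong h (v · e) = cong₂ _·_ (renV-cong h v) (renE-cong h e)

extS-cong : ∀ {n m} {σ σ' : Sub n m} → σ ≗ σ' → extS σ ≗ extS σ'
extS-cong h zero    = refl
extS-cong h (suc i) = cong (renV suc) (h i)

mutual
  subC-cong : ∀ {n m} {σ σ' : Sub n m} → σ ≗ σ' → subC σ ≗ subC σ'
  subC-cong h ⟨ v ∣ e ⟩ = cong₂ ⟨_∣_⟩ (subV-cong h v) (subE-cong h e)

  subV-cong : ∀ {n m} {σ σ' : Sub n m} → σ ≗ σ' → subV σ ≗ subV σ'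
  subV-cong h (var i) = h i
  subV-cong h (lam c) = cong lam (subC-cong (extS-cong h) c)

  subE-cong : ∀ {n m} {σ σ' : Sub n m} → σ ≗ σ' → subE σ ≗ subE σ'
  subE-cong h ε       = refl
  subE-cong h (μ̃ c)   = cong μ̃ (subC-cong (extS-cong h) c)
  subE-cong h (v · e) = cong₂ _·_ (subV-cong h v) (subE-cong h e)

extR-∘ : ∀ {n m k} (ρ : Ren m k) (ρ' : Ren n m) → extR ρ ∘ extR ρ' ≗ extR (ρ ∘ ρ')
extR-∘ ρ ρ' zero    = refl
extR-∘ ρ ρ' (suc i) = refl

mutual
  renC-∘ : ∀ {n m k} (ρ : Ren m k) (ρ' : Ren n m) → renC ρ ∘ renC ρ' ≗ renC (ρ ∘ ρ')
  renC-∘ ρ ρ' ⟨ v ∣ e ⟩ = cong₂ ⟨_∣_⟩ (renV-∘ ρ ρ' v) (renE-∘ ρ ρ' e)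

  renV-∘ : ∀ {n m k} (ρ : Ren m k) (ρ' : Ren n m) → renV ρ ∘ renV ρ' ≗ renV (ρ ∘ ρ')
  renV-∘ ρ ρ' (var i) = refl
  renV-∘ ρ ρ' (lam c) = cong lam (renC-∘-ext ρ ρ' c)

  renE-∘ : ∀ {n m k} (ρ : Ren m k) (ρ' : Ren n m) → renE ρ ∘ renE ρ' ≗ renE (ρ ∘ ρ')
  renE-∘ ρ ρ' ε       = refl
  renE-∘ ρ ρ' (μ̃ c)   = cong μ̃ (renC-∘-ext ρ ρ' c)
  renE-∘ ρ ρ' (v · e) = cong₂ _·_ (renV-∘ ρ ρ' v) (renE-∘ ρ ρ' e)

  renC-∘-ext : ∀ {n m k} (ρ : Ren m k) (ρ' : Ren n m) →
               renC (extR ρ) ∘ renC (extR ρ') ≗ renC (extR (ρ ∘ ρ'))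
  renC-∘-ext ρ ρ' c = trans (renC-∘ (extR ρ) (extR ρ') c) (renC-cong (extR-∘ ρ ρ') c)

extS-extR : ∀ {n m k} (σ : Sub m k) (ρ : Ren n m) → extS σ ∘ extR ρ ≗ extS (σ ∘ ρ)
extS-extR σ ρ zero    = refl
extS-extR σ ρ (suc i) = refl

mutual
  subC-renC : ∀ {n m k} (σ : Sub m k) (ρ : Ren n m) → subC σ ∘ renC ρ ≗ subC (σ ∘ ρ)
  subC-renC σ ρ ⟨ v ∣ e ⟩ = cong₂ ⟨_∣_⟩ (subV-renV σ ρ v) (subE-renE σ ρ e)

  subV-renV : ∀ {n m k} (σ : Sub m k) (ρ : Ren n m) → subV σ ∘ renV ρ ≗ subV (σ ∘ ρ)
  subV-renV σ ρ (var i) = refl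
  subV-renV σ ρ (lam c) = cong lam (subC-renC-ext σ ρ c)

  subE-renE : ∀ {n m k} (σ : Sub m k) (ρ : Ren n m) → subE σ ∘ renE ρ ≗ subE (σ ∘ ρ)
  subE-renE σ ρ ε       = refl
  subE-renE σ ρ (μ̃ c)   = cong μ̃ (subC-renC-ext σ ρ c)
  subE-renE σ ρ (v · e) = cong₂ _·_ (subV-renV σ ρ v) (subE-renE σ ρ e)

  subC-renC-ext : ∀ {n m k} (σ : Sub m k) (ρ : Ren n m) →
                  subC (extS σ) ∘ renC (extR ρ) ≗ subC (extS (σ ∘ ρ))
  subC-renC-ext σ ρ c = trans (subC-renC (extS σ) (extR ρ) c) (subC-cong (extS-extR σ ρ) c)

extR-extS : ∀ {n m k} (ρ : Ren m k) (σ : Sub n m) → renV (extR ρ) ∘ extS σ ≗ extS (renV ρ ∘ σ)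
extR-extS ρ σ zero    = refl
extR-extS ρ σ (suc i) = trans (renV-∘ (extR ρ) suc (σ i)) (sym (renV-∘ suc ρ (σ i)))

mutual
  renC-subC : ∀ {n m k} (ρ : Ren m k) (σ : Sub n m) → renC ρ ∘ subC σ ≗ subC (renV ρ ∘ σ)
  renC-subC ρ σ ⟨ v ∣ e ⟩ = cong₂ ⟨_∣_⟩ (renV-subV ρ σ v) (renE-subE ρ σ e)

  renV-subV : ∀ {n m k} (ρ : Ren m k) (σ : Sub n m) → renV ρ ∘ subV σ ≗ subV (renV ρ ∘ σ)
  renV-subV ρ σ (var i) = refl
  renV-subV ρ σ (lam c) = cong lam (renC-subC-ext ρ σ c)

  renE-subE : ∀ {n m k} (ρ : Ren m k) (σ : Sub n m) → renE ρ ∘ subE σ ≗ subE (renV ρ ∘ σ)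
  renE-subE ρ σ ε       = refl
  renE-subE ρ σ (μ̃ c)   = cong μ̃ (renC-subC-ext ρ σ c)
  renE-subE ρ σ (v · e) = cong₂ _·_ (renV-subV ρ σ v) (renE-subE ρ σ e)

  renC-subC-ext : ∀ {n m k} (ρ : Ren m k) (σ : Sub n m) →
                  renC (extR ρ) ∘ subC (extS σ) ≗ subC (extS (renV ρ ∘ σ))
  renC-subC-ext ρ σ c = trans (renC-subC (extR ρ) (extS σ) c) (subC-cong (extR-extS ρ σ) c)

extS-∘ : ∀ {n m k} (σ : Sub m k) (τ : Sub n m) → subV (extS σ) ∘ extS τ ≗ extS (subV σ ∘ τ)
extS-∘ σ τ zero    = refl
extS-∘ σ τ (suc i) = trans (subV-renV (extS σ) suc (τ i)) (sym (renV-subV suc σ (τ i)))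

mutual
  subC-∘ : ∀ {n m k} (σ : Sub m k) (τ : Sub n m) → subC σ ∘ subC τ ≗ subC (subV σ ∘ τ)
  subC-∘ σ τ ⟨ v ∣ e ⟩ = cong₂ ⟨_∣_⟩ (subV-∘ σ τ v) (subE-∘ σ τ e)

  subV-∘ : ∀ {n m k} (σ : Sub m k) (τ : Sub n m) → subV σ ∘ subV τ ≗ subV (subV σ ∘ τ)
  subV-∘ σ τ (var i) = refl
  subV-∘ σ τ (lam c) = cong lam (subC-∘-ext σ τ c)

  subE-∘ : ∀ {n m k} (σ : Sub m k) (τ : Sub n m) → subE σ ∘ subE τ ≗ subE (subV σ ∘ τ)
  subE-∘ σ τ ε       = refl
  subE-∘ σ τ (μ̃ c)   = cong μ̃ (subC-∘-ext σ τ c)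
  subE-∘ σ τ (v · e) = cong₂ _·_ (subV-∘ σ τ v) (subE-∘ σ τ e)

  subC-∘-ext : ∀ {n m k} (σ : Sub m k) (τ : Sub n m) →
               subC (extS σ) ∘ subC (extS τ) ≗ subC (extS (subV σ ∘ τ))
  subC-∘-ext σ τ c = trans (subC-∘ (extS σ) (extS τ) c) (subC-cong (extS-∘ σ τ) c)

extS-var : ∀ {n} → extS {n} var ≗ var
extS-var zero    = refl
extS-var (suc i) = refl

mutual
  subC-var : ∀ {n} → subC {n} var ≗ (λ c → c)
  subC-var ⟨ v ∣ e ⟩ = cong₂ ⟨_∣_⟩ (subV-var v) (subE-var e)

  subV-var : ∀ {n} → subV {n} var ≗ (λ v → v)
  subV-var (var i) = refl
  subV-var (lam c) = cong lam (trans (subC-cong extS-var c) (subC-var c))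

  subE-var : ∀ {n} → subE {n} var ≗ (λ e → e)
  subE-var ε       = refl
  subE-var (μ̃ c)   = cong μ̃ (trans (subC-cong extS-var c) (subC-var c))
  subE-var (v · e) = cong₂ _·_ (subV-var v) (subE-var e)

extR-as-extS : ∀ {n m} (ρ : Ren n m) → var ∘ extR ρ ≗ extS (var ∘ ρ)
extR-as-extS ρ zero    = refl
extR-as-extS ρ (suc i) = refl

mutual
  renC-as-subC : ∀ {n m} (ρ : Ren n m) → renC ρ ≗ subC (var ∘ ρ)
  renC-as-subC ρ ⟨ v ∣ e ⟩ = cong₂ ⟨_∣_⟩ (renV-as-subV ρ v) (renE-as-subE ρ e)

  renV-as-subV : ∀ {n m} (ρ : Ren n m) → renV ρ ≗ subV (var ∘ ρ)
  renV-as-subV ρ (var i) = refl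
  renV-as-subV ρ (lam c) = cong lam (trans (renC-as-subC (extR ρ) c) (subC-cong (extR-as-extS ρ) c))

  renE-as-subE : ∀ {n m} (ρ : Ren n m) → renE ρ ≗ subE (var ∘ ρ)
  renE-as-subE ρ ε       = refl
  renE-as-subE ρ (μ̃ c)   = cong μ̃ (trans (renC-as-subC (extR ρ) c) (subC-cong (extR-as-extS ρ) c))
  renE-as-subE ρ (v · e) = cong₂ _·_ (renV-as-subV ρ v) (renE-as-subE ρ e)

mutual
  subC-++C : ∀ {n m} (σ : Sub n m) c e → subC σ (c ++C e) ≡ subC σ c ++C subE σ e
  subC-++C σ ⟨ v ∣ e' ⟩ e = cong ⟨ subV σ v ∣_⟩ (subE-++E σ e' e)

  subE-++E : ∀ {n m} (σ : Sub n m) e' e → subE σ (e' ++E e) ≡ subE σ e' ++E subE σ e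
  subE-++E σ ε        e = refl
  subE-++E σ (v · e') e = cong (subV σ v ·_) (subE-++E σ e' e)
  subE-++E σ (μ̃ c)    e = cong μ̃ (begin
    subC (extS σ) (c ++C renE suc e)               ≡⟨ subC-++C (extS σ) c (renE suc e) ⟩
    subC (extS σ) c ++C subE (extS σ) (renE suc e) ≡⟨ cong (subC (extS σ) c ++C_) weaken-commutes ⟩
    subC (extS σ) c ++C renE suc (subE σ e)        ∎)
    where
    open ≡-Reasoning
    weaken-commutes : subE (extS σ) (renE suc e) ≡ renE suc (subE σ e)
    weaken-commutes = trans (subE-renE (extS σ) suc e) (sym (renE-subE suc σ e))

single-extS : ∀ {n m} (σ : Sub n m) (v : Val n) →
              subV σ ∘ single v ≗ subV (single (subV σ v)) ∘ extS σ
single-extS σ v zero    = refl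
single-extS σ v (suc i) = sym (trans (subV-renV (single (subV σ v)) suc (σ i)) (subV-var (σ i)))

subC-[] : ∀ {n m} (σ : Sub n m) (c : Cmd (suc n)) (v : Val n) →
          subC σ (c [ v ]) ≡ subC (extS σ) c [ subV σ v ]
subC-[] σ c v = begin
  subC σ (subC (single v) c)                   ≡⟨ subC-∘ σ (single v) c ⟩
  subC (subV σ ∘ single v) c                   ≡⟨ subC-cong (single-extS σ v) c ⟩
  subC (subV (single (subV σ v)) ∘ extS σ) c   ≡⟨ subC-∘ (single (subV σ v)) (extS σ) c ⟨
  subC (single (subV σ v)) (subC (extS σ) c)   ∎
  where open ≡-Reasoning

data Kind : Set where
  λ̄ₖ μ̃ₖ : Kind

Root : Kind → ∀ {n} → Cmd n → Cmd n → Set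
Root λ̄ₖ = _↦λ̄_
Root μ̃ₖ = _↦μ̃_

-- The contextual closure presented inductively: a context C is a path of
-- environment positions, descending through stack cells and μ̃-binders.
mutual
  data Step (k : Kind) : ∀ {n} → Cmd n → Cmd n → Set where
    root  : ∀ {n} {c c' : Cmd n} → Root k c c' → Step k c c'
    inEnv : ∀ {n} {v : Val n} {e e'} → StepE k e e' → Step k ⟨ v ∣ e ⟩ ⟨ v ∣ e' ⟩

  data StepE (k : Kind) : ∀ {n} → Env n → Env n → Set where
    inTail : ∀ {n} {v : Val n} {e e'} → StepE k e e' → StepE k (v · e) (v · e')
    inμ̃    : ∀ {n} {c c' : Cmd (suc n)} → Step k c c' → StepE k (μ̃ c) (μ̃ c')

mutual
  subC-Step : ∀ {k n m} {c c' : Cmd n} (σ : Sub n m) → Step k c c' → Step k (subC σ c) (subC σ c')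
  subC-Step {λ̄ₖ} σ (root (λ̄-rule c v e)) =
    subst (Step λ̄ₖ (subC σ ⟨ lam c ∣ v · e ⟩) ∘ ⟨ subV σ v ∣_⟩) (sym (subE-++E σ (μ̃ c) e))
          (root (λ̄-rule _ _ _))
  subC-Step {μ̃ₖ} σ (root (μ̃-rule v c)) = subst (Step μ̃ₖ _) (sym (subC-[] σ c v)) (root (μ̃-rule _ _))
  subC-Step σ (inEnv s) = inEnv (subE-StepE σ s)

  subE-StepE : ∀ {k n m} {e e' : Env n} (σ : Sub n m) → StepE k e e' → StepE k (subE σ e) (subE σ e')
  subE-StepE σ (inTail s) = inTail (subE-StepE σ s)
  subE-StepE σ (inμ̃ s)    = inμ̃ (subC-Step (extS σ) s)

renE-StepE : ∀ {k n m} {e e' : Env n} (ρ : Ren n m) → StepE k e e' → StepE k (renE ρ e) (renE ρ e')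
renE-StepE {k} ρ s =
  subst₂ (StepE k) (sym (renE-as-subE ρ _)) (sym (renE-as-subE ρ _)) (subE-StepE (var ∘ ρ) s)

mutual
  ++C-StepE : ∀ {k n} {e e' : Env n} (c : Cmd n) → StepE k e e' → Step k (c ++C e) (c ++C e')
  ++C-StepE ⟨ v ∣ e₁ ⟩ s = inEnv (++E-StepE e₁ s)

  ++E-StepE : ∀ {k n} {e e' : Env n} (e₁ : Env n) → StepE k e e' → StepE k (e₁ ++E e) (e₁ ++E e')
  ++E-StepE ε        s = s
  ++E-StepE (v · e₁) s = inTail (++E-StepE e₁ s)
  ++E-StepE (μ̃ c)    s = inμ̃ (++C-StepE c (renE-StepE suc s))

root-deterministic : ∀ k₁ k₂ {n} {t u s : Cmd n} → Root k₁ t u → Root k₂ t s → k₁ ≡ k₂ × u ≡ s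
root-deterministic λ̄ₖ λ̄ₖ (λ̄-rule c v e) (λ̄-rule .c .v .e) = refl , refl
root-deterministic μ̃ₖ μ̃ₖ (μ̃-rule v c)   (μ̃-rule .v .c)   = refl , refl
root-deterministic λ̄ₖ μ̃ₖ (λ̄-rule c v e) ()
root-deterministic μ̃ₖ λ̄ₖ (μ̃-rule v c)   ()

root-inEnv : ∀ k₁ {k₂ n} {v : Val n} {e e' u} → Root k₁ ⟨ v ∣ e ⟩ u → StepE k₂ e e' →
             Joinable (Step k₂) (Step k₁) u ⟨ v ∣ e' ⟩
root-inEnv λ̄ₖ (λ̄-rule c v e) (inTail {e' = e'} s) = _ , inEnv (++E-StepE (μ̃ c) s) , root (λ̄-rule c v e')
root-inEnv μ̃ₖ (μ̃-rule v c)   (inμ̃ {c' = c'} s)    = _ , subC-Step (single v) s , root (μ̃-rule v c')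

mutual
  Step-diamond : ∀ {k₁ k₂ n} {t u s : Cmd n} → Step k₁ t u → Step k₂ t s →
                 (k₁ ≡ k₂ × u ≡ s) ⊎ Joinable (Step k₂) (Step k₁) u s
  Step-diamond {k₁} {k₂} (root x) (root y) = inj₁ (root-deterministic k₁ k₂ x y)
  Step-diamond {k₁} (root x) (inEnv s) = inj₂ (root-inEnv k₁ x s)
  Step-diamond {k₂ = k₂} (inEnv s) (root y) with root-inEnv k₂ y s
  ... | r , x , y' = inj₂ (r , y' , x)
  Step-diamond (inEnv s₁) (inEnv s₂) with StepE-diamond s₁ s₂
  ... | inj₁ (k≡ , u≡s)  = inj₁ (k≡ , cong ⟨ _ ∣_⟩ u≡s)
  ... | inj₂ (r , x , y) = inj₂ (⟨ _ ∣ r ⟩ , inEnv x , inEnv y)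

  StepE-diamond : ∀ {k₁ k₂ n} {t u s : Env n} → StepE k₁ t u → StepE k₂ t s →
                  (k₁ ≡ k₂ × u ≡ s) ⊎ Joinable (StepE k₂) (StepE k₁) u s
  StepE-diamond (inTail s₁) (inTail s₂) with StepE-diamond s₁ s₂
  ... | inj₁ (k≡ , u≡s)  = inj₁ (k≡ , cong (_ ·_) u≡s)
  ... | inj₂ (r , x , y) = inj₂ (_ · r , inTail x , inTail y)
  StepE-diamond (inμ̃ s₁) (inμ̃ s₂) with Step-diamond s₁ s₂
  ... | inj₁ (k≡ , u≡s)  = inj₁ (k≡ , cong μ̃ u≡s)
  ... | inj₂ (r , x , y) = inj₂ (μ̃ r , inμ̃ x , inμ̃ y)

Closure : Kind → ∀ {n} → Cmd n → Cmd n → Set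
Closure λ̄ₖ = _→λ̄_
Closure μ̃ₖ = _→μ̃_

plugD-StepE : ∀ {k n} (D : DCtx n) {e e' : Env n} → StepE k e e' → Step k (plugD D e) (plugD D e')
plugD-StepE ⟨ v ∣□⟩     s = inEnv s
plugD-StepE (D ⟨ v ·□⟩) s = plugD-StepE D (inTail s)

plugC-Step : ∀ {k n m} (C : CCtx n m) {c c' : Cmd m} → Root k c c' → Step k (plugC C c) (plugC C c')
plugC-Step □            r = root r
plugC-Step (D ⟨μ̃ C ⟩) r = plugD-StepE D (inμ̃ (plugC-Step C r))

Closure⇒Step : ∀ k {n} {c c' : Cmd n} → Closure k c c' → Step k c c'
Closure⇒Step λ̄ₖ (ctx C r) = plugC-Step C r
Closure⇒Step μ̃ₖ (ctx C r) = plugC-Step C r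

Closure-plugD-μ̃ : ∀ k {n} (D : DCtx n) {c c' : Cmd (suc n)} →
                  Closure k c c' → Closure k (plugD D (μ̃ c)) (plugD D (μ̃ c'))
Closure-plugD-μ̃ λ̄ₖ D (ctx C r) = ctx (D ⟨μ̃ C ⟩) r
Closure-plugD-μ̃ μ̃ₖ D (ctx C r) = ctx (D ⟨μ̃ C ⟩) r

Closure-root : ∀ k {n} {c c' : Cmd n} → Root k c c' → Closure k c c'
Closure-root λ̄ₖ r = ctx □ r
Closure-root μ̃ₖ r = ctx □ r

mutual
  Step⇒Closure : ∀ {k n} {c c' : Cmd n} → Step k c c' → Closure k c c'
  Step⇒Closure {k} (root r) = Closure-root k r
  Step⇒Closure (inEnv s)    = StepE⇒Closure ⟨ _ ∣□⟩ s

  StepE⇒Closure : ∀ {k n} (D : DCtx n) {e e' : Env n} → StepE k e e' → Closure k (plugD D e) (plugD D e')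
  StepE⇒Closure D (inTail s)    = StepE⇒Closure (D ⟨ _ ·□⟩) s
  StepE⇒Closure {k} D (inμ̃ s)   = Closure-plugD-μ̃ k D (Step⇒Closure s)

kind : ∀ {n} {c c' : Cmd n} → c →vseq c' → Kind
kind (inj₁ _) = λ̄ₖ
kind (inj₂ _) = μ̃ₖ

vseq⇒Step : ∀ {n} {c c' : Cmd n} (x : c →vseq c') → Step (kind x) c c'
vseq⇒Step (inj₁ x) = Closure⇒Step λ̄ₖ x
vseq⇒Step (inj₂ x) = Closure⇒Step μ̃ₖ x

Step⇒vseq : ∀ k {n} {c c' : Cmd n} → Step k c c' → c →vseq c'
Step⇒vseq λ̄ₖ s = inj₁ (Step⇒Closure s)
Step⇒vseq μ̃ₖ s = inj₂ (Step⇒Closure s)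

kind-Step⇒vseq : ∀ k {n} {c c' : Cmd n} (s : Step k c c') → kind (Step⇒vseq k s) ≡ k
kind-Step⇒vseq λ̄ₖ s = refl
kind-Step⇒vseq μ̃ₖ s = refl

mutual
  lamsC : ∀ {n} → Cmd n → ℕ
  lamsC ⟨ v ∣ e ⟩ = lamsV v + lamsE e

  lamsV : ∀ {n} → Val n → ℕ
  lamsV (var i) = 0
  lamsV (lam c) = suc (lamsC c)

  lamsE : ∀ {n} → Env n → ℕ
  lamsE ε       = 0
  lamsE (μ̃ c)   = lamsC c
  lamsE (v · e) = lamsV v + lamsE e

mutual
  lamsC-renC : ∀ {n m} (ρ : Ren n m) c → lamsC (renC ρ c) ≡ lamsC c
  lamsC-renC ρ ⟨ v ∣ e ⟩ = cong₂ _+_ (lamsV-renV ρ v) (lamsE-renE ρ e)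

  lamsV-renV : ∀ {n m} (ρ : Ren n m) v → lamsV (renV ρ v) ≡ lamsV v
  lamsV-renV ρ (var i) = refl
  lamsV-renV ρ (lam c) = cong suc (lamsC-renC (extR ρ) c)

  lamsE-renE : ∀ {n m} (ρ : Ren n m) e → lamsE (renE ρ e) ≡ lamsE e
  lamsE-renE ρ ε       = refl
  lamsE-renE ρ (μ̃ c)   = lamsC-renC (extR ρ) c
  lamsE-renE ρ (v · e) = cong₂ _+_ (lamsV-renV ρ v) (lamsE-renE ρ e)

mutual
  lamsC-++C : ∀ {n} (c : Cmd n) e → lamsC (c ++C e) ≡ lamsC c + lamsE e
  lamsC-++C ⟨ v ∣ e' ⟩ e = trans (cong (lamsV v +_) (lamsE-++E e' e)) (sym (+-assoc (lamsV v) (lamsE e') (lamsE e)))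

  lamsE-++E : ∀ {n} (e' : Env n) e → lamsE (e' ++E e) ≡ lamsE e' + lamsE e
  lamsE-++E ε        e = refl
  lamsE-++E (v · e') e = trans (cong (lamsV v +_) (lamsE-++E e' e)) (sym (+-assoc (lamsV v) (lamsE e') (lamsE e)))
  lamsE-++E (μ̃ c)    e = trans (lamsC-++C c (renE suc e)) (cong (lamsC c +_) (lamsE-renE suc e))

mutual
  lamsC-λ̄ : ∀ {n} {c c' : Cmd n} → Step λ̄ₖ c c' → lamsC c ≡ suc (lamsC c')
  lamsC-λ̄ (root (λ̄-rule c v e)) = cong suc (begin
    lamsC c + (lamsV v + lamsE e)   ≡⟨ +-assoc (lamsC c) (lamsV v) (lamsE e) ⟨
    (lamsC c + lamsV v) + lamsE e   ≡⟨ cong (_+ lamsE e) (+-comm (lamsC c) (lamsV v)) ⟩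
    (lamsV v + lamsC c) + lamsE e   ≡⟨ +-assoc (lamsV v) (lamsC c) (lamsE e) ⟩
    lamsV v + (lamsC c + lamsE e)   ≡⟨ cong (lamsV v +_) (lamsE-++E (μ̃ c) e) ⟨
    lamsV v + lamsE (μ̃ c ++E e)     ∎)
    where open ≡-Reasoning
  lamsC-λ̄ (inEnv {v = v} s) = trans (cong (lamsV v +_) (lamsE-λ̄ s)) (+-suc (lamsV v) _)

  lamsE-λ̄ : ∀ {n} {e e' : Env n} → StepE λ̄ₖ e e' → lamsE e ≡ suc (lamsE e')
  lamsE-λ̄ (inTail {v = v} s) = trans (cong (lamsV v +_) (lamsE-λ̄ s)) (+-suc (lamsV v) _)
  lamsE-λ̄ (inμ̃ s)            = lamsC-λ̄ s

-- μ̃-binders outside values; substitution, acting only on values, preserves it.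
mutual
  μ̃-depthC : ∀ {n} → Cmd n → ℕ
  μ̃-depthC ⟨ v ∣ e ⟩ = μ̃-depthE e

  μ̃-depthE : ∀ {n} → Env n → ℕ
  μ̃-depthE ε       = 0
  μ̃-depthE (μ̃ c)   = suc (μ̃-depthC c)
  μ̃-depthE (v · e) = μ̃-depthE e

mutual
  μ̃-depthC-subC : ∀ {n m} (σ : Sub n m) c → μ̃-depthC (subC σ c) ≡ μ̃-depthC c
  μ̃-depthC-subC σ ⟨ v ∣ e ⟩ = μ̃-depthE-subE σ e

  μ̃-depthE-subE : ∀ {n m} (σ : Sub n m) e → μ̃-depthE (subE σ e) ≡ μ̃-depthE e
  μ̃-depthE-subE σ ε       = refl
  μ̃-depthE-subE σ (μ̃ c)   = cong suc (μ̃-depthC-subC (extS σ) c)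
  μ̃-depthE-subE σ (v · e) = μ̃-depthE-subE σ e

μ̃-depthE-renE : ∀ {n m} (ρ : Ren n m) e → μ̃-depthE (renE ρ e) ≡ μ̃-depthE e
μ̃-depthE-renE ρ e = trans (cong μ̃-depthE (renE-as-subE ρ e)) (μ̃-depthE-subE (var ∘ ρ) e)

mutual
  μ̃-depthC-++C : ∀ {n} (c : Cmd n) e → μ̃-depthC (c ++C e) ≡ μ̃-depthC c + μ̃-depthE e
  μ̃-depthC-++C ⟨ v ∣ e' ⟩ e = μ̃-depthE-++E e' e

  μ̃-depthE-++E : ∀ {n} (e' : Env n) e → μ̃-depthE (e' ++E e) ≡ μ̃-depthE e' + μ̃-depthE e
  μ̃-depthE-++E ε        e = refl
  μ̃-depthE-++E (v · e') e = μ̃-depthE-++E e' e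
  μ̃-depthE-++E (μ̃ c)    e =
    cong suc (trans (μ̃-depthC-++C c (renE suc e)) (cong (μ̃-depthC c +_) (μ̃-depthE-renE suc e)))

mutual
  μ̃-depthC-μ̃ : ∀ {n} {c c' : Cmd n} → Step μ̃ₖ c c' → μ̃-depthC c ≡ suc (μ̃-depthC c')
  μ̃-depthC-μ̃ (root (μ̃-rule v c)) = cong suc (sym (μ̃-depthC-subC (single v) c))
  μ̃-depthC-μ̃ (inEnv s)            = μ̃-depthE-μ̃ s

  μ̃-depthE-μ̃ : ∀ {n} {e e' : Env n} → StepE μ̃ₖ e e' → μ̃-depthE e ≡ suc (μ̃-depthE e')
  μ̃-depthE-μ̃ (inTail s) = μ̃-depthE-μ̃ s
  μ̃-depthE-μ̃ (inμ̃ s)    = cong suc (μ̃-depthC-μ̃ s)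

mutual
  μ̃-depthC-λ̄ : ∀ {n} {c c' : Cmd n} → Step λ̄ₖ c c' → μ̃-depthC c < μ̃-depthC c'
  μ̃-depthC-λ̄ (root (λ̄-rule c v e)) =
    subst (μ̃-depthE e <_) (sym (μ̃-depthE-++E (μ̃ c) e)) (s≤s (m≤n+m _ (μ̃-depthC c)))
  μ̃-depthC-λ̄ (inEnv s) = μ̃-depthE-λ̄ s

  μ̃-depthE-λ̄ : ∀ {n} {e e' : Env n} → StepE λ̄ₖ e e' → μ̃-depthE e < μ̃-depthE e'
  μ̃-depthE-λ̄ (inTail s) = μ̃-depthE-λ̄ s
  μ̃-depthE-λ̄ (inμ̃ s)    = s≤s (μ̃-depthC-λ̄ s)

Closure-stronglyConfluent : ∀ k {n} → StronglyConfluent (Closure k {n})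
Closure-stronglyConfluent k x y u≢s with Step-diamond (Closure⇒Step k x) (Closure⇒Step k y)
... | inj₁ (_ , s≡u)   = ⊥-elim (u≢s (sym s≡u))
... | inj₂ (r , x' , y') = r , Step⇒Closure y' , Step⇒Closure x'

λ̄-stronglyNormalizing : ∀ {n} → StronglyNormalizing (_→λ̄_ {n})
λ̄-stronglyNormalizing = decreasing⇒SN {_⇒_ = _→λ̄_} lamsC λ x → ≤-reflexive (sym (lamsC-λ̄ (Closure⇒Step λ̄ₖ x)))

μ̃-stronglyNormalizing : ∀ {n} → StronglyNormalizing (_→μ̃_ {n})
μ̃-stronglyNormalizing = decreasing⇒SN {_⇒_ = _→μ̃_} μ̃-depthC λ y → ≤-reflexive (sym (μ̃-depthC-μ̃ (Closure⇒Step μ̃ₖ y)))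

λ̄-μ̃-distinct : ∀ {n} {t u s : Cmd n} → t →λ̄ u → t →μ̃ s → u ≢ s
λ̄-μ̃-distinct x y refl =
  <-irrefl refl (<-trans (μ̃-depthC-λ̄ (Closure⇒Step λ̄ₖ x)) (≤-reflexive (sym (μ̃-depthC-μ̃ (Closure⇒Step μ̃ₖ y)))))

λ̄-μ̃-stronglyCommute : ∀ {n} → StronglyCommute (_→λ̄_ {n}) (_→μ̃_ {n})
λ̄-μ̃-stronglyCommute x y with Step-diamond (Closure⇒Step λ̄ₖ x) (Closure⇒Step μ̃ₖ y)
... | inj₁ (() , _)
... | inj₂ (r , y' , x') = λ̄-μ̃-distinct x y , r , Step⇒Closure y' , Step⇒Closure x'

module VseqRewriting (n : ℕ) = LabelledRewriting (_→vseq_ {n}) kind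

vseq-labelledDiamond : ∀ {n} → VseqRewriting.LabelledDiamond n
vseq-labelledDiamond x y with Step-diamond (vseq⇒Step x) (vseq⇒Step y)
... | inj₁ kinds-and-targets = inj₁ kinds-and-targets
... | inj₂ (r , y' , x') =
  inj₂ (r , Step⇒vseq _ y' , Step⇒vseq _ x' , kind-Step⇒vseq _ y' , kind-Step⇒vseq _ x')

isλ̄ isμ̃ : Kind → ℕ
isλ̄ λ̄ₖ = 1
isλ̄ μ̃ₖ = 0
isμ̃ λ̄ₖ = 0
isμ̃ μ̃ₖ = 1

module _ {n : ℕ} where
  open VseqRewriting n using (weight)

  ∣∣-weight : ∀ {c c' : Cmd n} (d : Derivation c c') → ∣ d ∣ ≡ weight (const 1) d
  ∣∣-weight ε       = refl
  ∣∣-weight (x ◅ d) = cong suc (∣∣-weight d)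

  ∣∣μ̃-weight : ∀ {c c' : Cmd n} (d : Derivation c c') → ∣ d ∣μ̃ ≡ weight isμ̃ d
  ∣∣μ̃-weight ε            = refl
  ∣∣μ̃-weight (inj₁ _ ◅ d) = ∣∣μ̃-weight d
  ∣∣μ̃-weight (inj₂ _ ◅ d) = cong suc (∣∣μ̃-weight d)

  ∣∣λ̄-weight : ∀ {c c' : Cmd n} (d : Derivation c c') → ∣ d ∣λ̄ ≡ weight isλ̄ d
  ∣∣λ̄-weight ε            = refl
  ∣∣λ̄-weight (inj₁ _ ◅ d) = cong suc (∣∣λ̄-weight d)
  ∣∣λ̄-weight (inj₂ _ ◅ d) = ∣∣λ̄-weight d

  normalizing-count-unique :
    (count : ∀ {c c' : Cmd n} → Derivation c c' → ℕ) (w : Kind → ℕ) →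
    (∀ {c c' : Cmd n} (d : Derivation c c') → count d ≡ weight w d) →
    ∀ {c c₁ c₂ : Cmd n} (d₁ : Derivation c c₁) (d₂ : Derivation c c₂) →
    Normal _→vseq_ c₁ → Normal _→vseq_ c₂ → count d₁ ≡ count d₂
  normalizing-count-unique count w count≡weight d₁ d₂ nf₁ nf₂ = begin
    count d₁     ≡⟨ count≡weight d₁ ⟩
    weight w d₁  ≡⟨ VseqRewriting.normalizing-weight-unique n vseq-labelledDiamond d₁ d₂ nf₁ nf₂ w ⟩
    weight w d₂  ≡⟨ count≡weight d₂ ⟨
    count d₂     ∎
    where open ≡-Reasoning

proposition6 :
    ∀ (n : ℕ) →
      ((StronglyNormalizing (_→λ̄_ {n}) × StronglyConfluent (_→λ̄_ {n}))
        × (StronglyNormalizing (_→μ̃_ {n}) × StronglyConfluent (_→μ̃_ {n})))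
      × StronglyCommute (_→λ̄_ {n}) (_→μ̃_ {n})
      × (StronglyConfluent (_→vseq_ {n})
        × (∀ (c c₁ c₂ : Cmd n) (d₁ : Derivation c c₁) (d₂ : Derivation c c₂) →
             Normal _→vseq_ c₁ → Normal _→vseq_ c₂ →
             (∣ d₁ ∣ ≡ ∣ d₂ ∣) × (∣ d₁ ∣μ̃ ≡ ∣ d₂ ∣μ̃) × (∣ d₁ ∣λ̄ ≡ ∣ d₂ ∣λ̄)))
proposition6 n =
    ( (λ̄-stronglyNormalizing , Closure-stronglyConfluent λ̄ₖ)
    , (μ̃-stronglyNormalizing , Closure-stronglyConfluent μ̃ₖ))
  , λ̄-μ̃-stronglyCommute
  , ( VseqRewriting.stronglyConfluent n vseq-labelledDiamond
    , λ c c₁ c₂ d₁ d₂ nf₁ nf₂ →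
        normalizing-count-unique ∣_∣ (const 1) ∣∣-weight d₁ d₂ nf₁ nf₂
      , normalizing-count-unique ∣_∣μ̃ isμ̃ ∣∣μ̃-weight d₁ d₂ nf₁ nf₂
      , normalizing-count-unique ∣_∣λ̄ isλ̄ ∣∣λ̄-weight d₁ d₂ nf₁ nf₂)
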